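{- Let $x$ be a prime such that $a=x^4+x^3+x^2+x+1$ is prime. Then $a^2+a+1$ has at least two distinct prime factors. Furthermore, if $a^2+a+1=bc$ for two distinct primes $b$ and $c$, then $11\mid b^4+b^3+b^2+b+1$ or $11\mid c^4+c^3+c^2+c+1$. -}

module Defs where

open import Data.Nat using (ℕ; _+_; _*_; _^_)

Φ₅ : ℕ → ℕ
Φ₅ x = x ^ 4 + x ^ 3 + x ^ 2 + x + 1

Φ₃ : ℕ → ℕ
Φ₃ a = a ^ 2 + a + 1

module Submission where

-- Write the prime x as y + 1 with y ≥ 1, and let a = Φ₅(x).  The proof rests on
-- two polynomial identities in y:
--   Φ₃(Φ₅(y + 1)) = Φ₃(y) · H(y)             with H of degree 6,
--   A(y) · Φ₃(y) = B(y) · H(y) + 31,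
-- so Φ₃(a) splits into two factors greater than 1 whose common divisors all
-- divide 31.  Moreover H(y) > 31, and Φ₃(y) = 31 only for y = 5, i.e. x = 6.
--
-- Part 1 is then an instance of a general fact: if m, n > 1 differ from a prime p
-- and every common divisor of m and n divides p, then m · n has two distinct prime
-- divisors.  Part 2 uses that b · c = m · n with m, n > 1 forces {m, n} = {b, c},
-- so {b, c} = {Φ₃(y), H(y)}; a finite check of the residues of y modulo 11 shows
-- that 11 divides Φ₅(y + 1), Φ₅(Φ₃(y)) or Φ₅(H(y)), and the first option is
-- excluded because Φ₅(x) is a prime larger than 11.

open import Defs
open import Data.Nat using (ℕ; _*_)
open import Data.Nat.Primality using (Prime)
open import Data.Nat.Divisibility using (_∣_)
open import Data.Product using (_×_; ∃-syntax)
open import Data.Sum using (_⊎_)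
open import Relation.Binary.PropositionalEquality using (_≡_; _≢_)

open import Data.Nat using (zero; suc; _+_; _^_; _%_; _≤_; _<_; z≤n; s≤s; _≟_; _<?_; NonZero; nonTrivial⇒n>1)
open import Data.Nat.Properties
  using (*-identityˡ; *-comm; *-assoc; *-cancelˡ-≡; *-cancelʳ-≡; +-mono-≤; ^-monoˡ-≤;
         ≤-refl; m≤m+n; m≤n+m; m<n+m; <-≤-trans; <-trans; <-irrefl; >⇒≢; m<m*n; allUpTo?)
open import Data.Nat.DivMod using (%-distribˡ-+; %-distribˡ-*; m%n%n≡m%n; m%n<n)
open import Data.Nat.Divisibility
  using (divides; _∣?_; _∣0; ∣m+n∣m⇒∣n; ∣m⇒∣m*n; ∣n⇒∣m*n; m∣m*n; *-monoˡ-∣; >⇒∤;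
         m%n≡0⇒n∣m; n∣m⇒m%n≡0)
open import Data.Nat.Primality
  using (prime⇒irreducible; prime⇒nonZero; prime⇒nonTrivial; euclidsLemma; prime?; composite⇒¬prime; composite[6])
open import Data.Nat.Primality.Factorisation using (factorise)
open import Data.Nat.ListAction using (product)
open import Data.Nat.Solver using (module +-*-Solver)
open import Data.List using ([]; _∷_)
open import Data.List.Relation.Unary.All using (_∷_)
open import Data.Product using (_,_)
open import Data.Sum using (inj₁; inj₂) renaming (swap to ⊎-swap)
import Data.Sum as Sum
open import Relation.Nullary using (¬_; yes; no; contradiction)
open import Relation.Nullary.Decidable using (from-yes; _⊎-dec_)
open import Relation.Binary.PropositionalEquality using (refl; sym; trans; cong; cong₂; subst; module ≡-Reasoning)
open ≡-Reasoning

prime-divisor : ∀ {n} → 1 < n → ∃[ p ] (Prime p × p ∣ n)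
prime-divisor {1} (s≤s ())
prime-divisor {suc (suc k)} _ with factorise (2 + k)
... | record { factors = [] ; isFactorisation = () }
... | record { factors = p ∷ ps ; isFactorisation = n≡∏ ; factorsPrime = prime-p ∷ _ } =
  p , prime-p , subst (p ∣_) (sym n≡∏) (m∣m*n (product ps))

prime⇒1<p : ∀ {p} → Prime p → 1 < p
prime⇒1<p {p} prime-p = nonTrivial⇒n>1 p {{prime⇒nonTrivial prime-p}}

prime⇒∤ : ∀ {p d} → Prime p → 1 < d → d < p → ¬ d ∣ p
prime⇒∤ prime-p 1<d d<p d∣p with prime⇒irreducible prime-p d∣p
... | inj₁ refl = <-irrefl refl 1<d
... | inj₂ refl = <-irrefl refl d<p

prime∣prime⇒≡ : ∀ {p q} → Prime p → Prime q → q ∣ p → q ≡ p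
prime∣prime⇒≡ prime-p prime-q q∣p with prime⇒irreducible prime-p q∣p
... | inj₂ q≡p = q≡p
... | inj₁ refl = contradiction (prime⇒1<p prime-q) (<-irrefl refl)

-- If p divides M exactly once and M ≠ p, then M has a prime divisor other than p
-- (a prime divisor of the cofactor M / p ≥ 2).
prime-divisor-other-than : ∀ {p M} → p ∣ M → ¬ (p * p ∣ M) → M ≢ p →
  ∃[ r ] (Prime r × r ∣ M × r ≢ p)
prime-divisor-other-than {p} (divides 0 refl) p²∤M _ = contradiction ((p * p) ∣0) p²∤M
prime-divisor-other-than {p} (divides 1 M≡p) _ M≢p = contradiction (trans M≡p (*-identityˡ p)) M≢p
prime-divisor-other-than {p} (divides k@(suc (suc _)) M≡kp) p²∤M _
  with prime-divisor {k} (s≤s (s≤s z≤n))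
... | r , prime-r , r∣k with r ≟ p
...   | yes refl = contradiction (subst (p * p ∣_) (sym M≡kp) (*-monoˡ-∣ p r∣k)) p²∤M
...   | no r≢p = r , prime-r , subst (r ∣_) (sym M≡kp) (∣m⇒∣m*n p r∣k) , r≢p

TwoPrimeDivisors : ℕ → Set
TwoPrimeDivisors N = ∃[ p ] ∃[ q ] (Prime p × Prime q × p ≢ q × p ∣ N × q ∣ N)

-- The case of two-prime-divisors where the prime p divides both m and n: since p² ∤ p,
-- p² cannot divide both, and the factor it misses has another prime divisor.
two-prime-divisors-sharing : ∀ {p m n} → Prime p → p ∣ m → p ∣ n → m ≢ p → n ≢ p →
  (∀ {d} → d ∣ m → d ∣ n → d ∣ p) → TwoPrimeDivisors (m * n)
two-prime-divisors-sharing {p} {m} {n} prime-p p∣m p∣n m≢p n≢p common with p * p ∣? n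
... | no p²∤n =
  let (r , prime-r , r∣n , r≢p) = prime-divisor-other-than p∣n p²∤n n≢p
  in p , r , prime-p , prime-r , (λ p≡r → r≢p (sym p≡r)) , ∣m⇒∣m*n n p∣m , ∣n⇒∣m*n m r∣n
... | yes p²∣n =
  let (r , prime-r , r∣m , r≢p) = prime-divisor-other-than p∣m p²∤m m≢p
  in r , p , prime-r , prime-p , r≢p , ∣m⇒∣m*n n r∣m , ∣n⇒∣m*n m p∣n
  where
  instance
    p≢0 : NonZero p
    p≢0 = prime⇒nonZero prime-p
  p²∤m : ¬ (p * p ∣ m)
  p²∤m p²∣m = >⇒∤ (m<m*n p p (prime⇒1<p prime-p)) (common p²∣m p²∣n)

two-prime-divisors : ∀ {p m n} → Prime p → 1 < m → 1 < n → m ≢ p → n ≢ p →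
  (∀ {d} → d ∣ m → d ∣ n → d ∣ p) → TwoPrimeDivisors (m * n)
two-prime-divisors {p} {m} {n} prime-p 1<m 1<n m≢p n≢p common
  with prime-divisor 1<m | prime-divisor 1<n
... | q , prime-q , q∣m | r , prime-r , r∣n with q ≟ r
...   | no q≢r = q , r , prime-q , prime-r , q≢r , ∣m⇒∣m*n n q∣m , ∣n⇒∣m*n m r∣n
...   | yes refl with prime∣prime⇒≡ prime-p prime-q (common q∣m r∣n)
...     | refl = two-prime-divisors-sharing prime-p q∣m r∣n m≢p n≢p common

prime-product-factor : ∀ {b c m n} → Prime b → Prime c → 1 < n → m * n ≡ b * c → b ∣ m →
  m ≡ b × n ≡ c
prime-product-factor {b} {c} {m} {n} prime-b prime-c 1<n mn≡bc (divides k m≡kb) = m≡b , n≡c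
  where
  instance
    b≢0 : NonZero b
    b≢0 = prime⇒nonZero prime-b
    c≢0 : NonZero c
    c≢0 = prime⇒nonZero prime-c
  kn≡c : k * n ≡ c
  kn≡c = *-cancelˡ-≡ (k * n) c b (begin
    b * (k * n) ≡⟨ sym (*-assoc b k n) ⟩
    b * k * n   ≡⟨ cong (_* n) (*-comm b k) ⟩
    k * b * n   ≡⟨ cong (_* n) (sym m≡kb) ⟩
    m * n       ≡⟨ mn≡bc ⟩
    b * c       ∎)
  n≡c : n ≡ c
  n≡c with prime⇒irreducible prime-c (divides k (sym kn≡c))
  ... | inj₁ refl = contradiction 1<n (<-irrefl refl)
  ... | inj₂ n≡c = n≡c
  m≡b : m ≡ b
  m≡b = *-cancelʳ-≡ m b c (subst (λ t → m * t ≡ b * c) n≡c mn≡bc)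

prime-product-factors : ∀ {b c m n} → Prime b → Prime c → 1 < m → 1 < n → m * n ≡ b * c →
  (m ≡ b × n ≡ c) ⊎ (m ≡ c × n ≡ b)
prime-product-factors {b} {c} {m} {n} prime-b prime-c 1<m 1<n mn≡bc
  with euclidsLemma m n prime-b (divides c (trans mn≡bc (*-comm b c)))
... | inj₁ b∣m = inj₁ (prime-product-factor prime-b prime-c 1<n mn≡bc b∣m)
... | inj₂ b∣n =
  let (n≡b , m≡c) = prime-product-factor prime-b prime-c 1<m (trans (*-comm n m) mn≡bc) b∣n
  in inj₂ (m≡c , n≡b)

prime-product-transfer : ∀ (P : ℕ → Set) {b c m n} → Prime b → Prime c → 1 < m → 1 < n →
  m * n ≡ b * c → P m ⊎ P n → P b ⊎ P c
prime-product-transfer P prime-b prime-c 1<m 1<n mn≡bc Pm⊎Pn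
  with prime-product-factors prime-b prime-c 1<m 1<n mn≡bc
... | inj₁ (refl , refl) = Pm⊎Pn
... | inj₂ (refl , refl) = ⊎-swap Pm⊎Pn

-- The cofactor of Φ₃(y) in Φ₃(Φ₅(y + 1)).
H : ℕ → ℕ
H y = y ^ 6 + 9 * y ^ 5 + 35 * y ^ 4 + 76 * y ^ 3 + 100 * y ^ 2 + 79 * y + 31

-- The multipliers of Φ₃ and H in their Bézout-type relation below.
A B : ℕ → ℕ
A y = 5 * y ^ 5 + 46 * y ^ 4 + 178 * y ^ 3 + 366 * y ^ 2 + 412 * y + 217
B y = 5 * y + 6

module _ where
  open +-*-Solver

  -- For x = y + 1, Φ₃(Φ₅(x)) has the factor Φ₃(y) = x² - x + 1.
  Φ₃∘Φ₅-factorisation : ∀ y → Φ₃ (Φ₅ (suc y)) ≡ Φ₃ y * H y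
  Φ₃∘Φ₅-factorisation = solve 1 (λ y →
    let x = con 1 :+ y ; a = x :^ 4 :+ x :^ 3 :+ x :^ 2 :+ x :+ con 1 in
    a :^ 2 :+ a :+ con 1
      := (y :^ 2 :+ y :+ con 1)
         :* (y :^ 6 :+ con 9 :* y :^ 5 :+ con 35 :* y :^ 4 :+ con 76 :* y :^ 3
             :+ con 100 :* y :^ 2 :+ con 79 :* y :+ con 31)) refl

  Φ₃-H-bezout : ∀ y → A y * Φ₃ y ≡ B y * H y + 31
  Φ₃-H-bezout = solve 1 (λ y →
    (con 5 :* y :^ 5 :+ con 46 :* y :^ 4 :+ con 178 :* y :^ 3 :+ con 366 :* y :^ 2
       :+ con 412 :* y :+ con 217) :* (y :^ 2 :+ y :+ con 1)
      := (con 5 :* y :+ con 6)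
         :* (y :^ 6 :+ con 9 :* y :^ 5 :+ con 35 :* y :^ 4 :+ con 76 :* y :^ 3
             :+ con 100 :* y :^ 2 :+ con 79 :* y :+ con 31) :+ con 31) refl

common-divisor∣ : ∀ {m n k d} a b → a * m ≡ b * n + k → d ∣ m → d ∣ n → d ∣ k
common-divisor∣ {d = d} a b am≡bn+k d∣m d∣n =
  ∣m+n∣m⇒∣n (subst (d ∣_) am≡bn+k (∣n⇒∣m*n a d∣m)) (∣n⇒∣m*n b d∣n)

Φ₃-H-common-divisor : ∀ y {d} → d ∣ Φ₃ y → d ∣ H y → d ∣ 31
Φ₃-H-common-divisor y = common-divisor∣ (A y) (B y) (Φ₃-H-bezout y)

<-sum : ∀ m {n} k → 0 < n → k < m + n + k
<-sum m {n} k 0<n = m<n+m k (<-≤-trans 0<n (m≤n+m n m))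

Φ₃>1 : ∀ z → 1 < Φ₃ (suc z)
Φ₃>1 z = <-sum (suc z ^ 2) 1 (s≤s z≤n)

H>31 : ∀ z → 31 < H (suc z)
H>31 z = <-sum (y ^ 6 + 9 * y ^ 5 + 35 * y ^ 4 + 76 * y ^ 3 + 100 * y ^ 2) 31 (s≤s z≤n)
  where y = suc z

Φ₃-mono : ∀ {a b} → a ≤ b → Φ₃ a ≤ Φ₃ b
Φ₃-mono a≤b = +-mono-≤ (+-mono-≤ (^-monoˡ-≤ 2 a≤b) a≤b) ≤-refl

Φ₅-mono : ∀ {a b} → a ≤ b → Φ₅ a ≤ Φ₅ b
Φ₅-mono a≤b =
  +-mono-≤ (+-mono-≤ (+-mono-≤ (+-mono-≤ (^-monoˡ-≤ 4 a≤b) (^-monoˡ-≤ 3 a≤b)) (^-monoˡ-≤ 2 a≤b)) a≤b) ≤-refl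

-- Φ₃(y) = 31 only for y = 5: check y ≤ 5, and Φ₃(y) ≥ Φ₃(6) = 43 beyond.
Φ₃≡31⇒y≡5 : ∀ y → Φ₃ y ≡ 31 → y ≡ 5
Φ₃≡31⇒y≡5 0 ()
Φ₃≡31⇒y≡5 1 ()
Φ₃≡31⇒y≡5 2 ()
Φ₃≡31⇒y≡5 3 ()
Φ₃≡31⇒y≡5 4 ()
Φ₃≡31⇒y≡5 5 _ = refl
Φ₃≡31⇒y≡5 (suc (suc (suc (suc (suc (suc w)))))) Φ₃y≡31 =
  contradiction Φ₃y≡31 (>⇒≢ (<-≤-trans (from-yes (31 <? Φ₃ 6)) (Φ₃-mono (m≤m+n 6 w))))

-- For a prime x = y + 1 we get Φ₃(y) ≠ 31, since x = 6 is not prime.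
Φ₃≢31 : ∀ y → Prime (suc y) → Φ₃ y ≢ 31
Φ₃≢31 y prime-x Φ₃y≡31 =
  composite⇒¬prime composite[6] (subst (λ t → Prime (suc t)) (Φ₃≡31⇒y≡5 y Φ₃y≡31) prime-x)

-- For x ≥ 2 a prime Φ₅(x) ≥ Φ₅(2) = 31 is not divisible by 11.
Φ₅-prime⇒11∤ : ∀ {x} → 2 ≤ x → Prime (Φ₅ x) → ¬ 11 ∣ Φ₅ x
Φ₅-prime⇒11∤ 2≤x prime-a =
  prime⇒∤ prime-a (from-yes (1 <? 11)) (<-≤-trans (from-yes (11 <? Φ₅ 2)) (Φ₅-mono 2≤x))

module Congruence (n : ℕ) .{{n≢0 : NonZero n}} where

  infix 4 _≈_
  record _≈_ (a b : ℕ) : Set where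
    constructor mk≈
    field remainders : a % n ≡ b % n

  ≈-refl : ∀ {a} → a ≈ a
  ≈-refl = mk≈ refl

  ≈-% : ∀ a → a ≈ a % n
  ≈-% a = mk≈ (sym (m%n%n≡m%n a n))

  +-cong : ∀ {a b c d} → a ≈ b → c ≈ d → a + c ≈ b + d
  +-cong {a} {b} {c} {d} (mk≈ a≡b) (mk≈ c≡d) = mk≈ (begin
    (a + c) % n             ≡⟨ %-distribˡ-+ a c n ⟩
    (a % n + c % n) % n     ≡⟨ cong₂ (λ u v → (u + v) % n) a≡b c≡d ⟩
    (b % n + d % n) % n     ≡⟨ %-distribˡ-+ b d n ⟨
    (b + d) % n             ∎)

  *-cong : ∀ {a b c d} → a ≈ b → c ≈ d → a * c ≈ b * d
  *-cong {a} {b} {c} {d} (mk≈ a≡b) (mk≈ c≡d) = mk≈ (begin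
    (a * c) % n             ≡⟨ %-distribˡ-* a c n ⟩
    (a % n * (c % n)) % n   ≡⟨ cong₂ (λ u v → (u * v) % n) a≡b c≡d ⟩
    (b % n * (d % n)) % n   ≡⟨ %-distribˡ-* b d n ⟨
    (b * d) % n             ∎)

  *-congˡ : ∀ k {a b} → a ≈ b → k * a ≈ k * b
  *-congˡ k = *-cong (≈-refl {k})

  ^-cong : ∀ {a b} → a ≈ b → ∀ k → a ^ k ≈ b ^ k
  ^-cong a≈b zero = ≈-refl
  ^-cong a≈b (suc k) = *-cong a≈b (^-cong a≈b k)

  ∣-resp-≈ : ∀ {a b} → a ≈ b → n ∣ b → n ∣ a
  ∣-resp-≈ {a} {b} (mk≈ a≡b) n∣b = m%n≡0⇒n∣m a n (trans a≡b (n∣m⇒m%n≡0 b n n∣b))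

  Φ₃-cong : ∀ {a b} → a ≈ b → Φ₃ a ≈ Φ₃ b
  Φ₃-cong a≈b = +-cong (+-cong (^-cong a≈b 2) a≈b) (≈-refl {1})

  Φ₅-cong : ∀ {a b} → a ≈ b → Φ₅ a ≈ Φ₅ b
  Φ₅-cong a≈b =
    +-cong (+-cong (+-cong (+-cong (^-cong a≈b 4) (^-cong a≈b 3)) (^-cong a≈b 2)) a≈b) (≈-refl {1})

  H-cong : ∀ {a b} → a ≈ b → H a ≈ H b
  H-cong a≈b =
    +-cong (+-cong (+-cong (+-cong (+-cong (+-cong
      (^-cong a≈b 6) (*-congˡ 9 (^-cong a≈b 5))) (*-congˡ 35 (^-cong a≈b 4)))
      (*-congˡ 76 (^-cong a≈b 3))) (*-congˡ 100 (^-cong a≈b 2))) (*-congˡ 79 a≈b)) (≈-refl {31})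

ElevenDividesΦ₅ : ℕ → Set
ElevenDividesΦ₅ y = 11 ∣ Φ₅ (suc y) ⊎ 11 ∣ Φ₅ (Φ₃ y) ⊎ 11 ∣ Φ₅ (H y)

eleven-divides-residue : ∀ {r} → r < 11 → ElevenDividesΦ₅ r
eleven-divides-residue = from-yes (allUpTo?
  (λ r → 11 ∣? Φ₅ (suc r) ⊎-dec 11 ∣? Φ₅ (Φ₃ r) ⊎-dec 11 ∣? Φ₅ (H r)) 11)

eleven-divides : ∀ y → ElevenDividesΦ₅ y
eleven-divides y = from-residue (eleven-divides-residue (m%n<n y 11))
  where
  open Congruence 11
  y≈r : y ≈ y % 11
  y≈r = ≈-% y
  from-residue : ElevenDividesΦ₅ (y % 11) → ElevenDividesΦ₅ y
  from-residue = Sum.map (∣-resp-≈ (Φ₅-cong (+-cong (≈-refl {1}) y≈r)))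
    (Sum.map (∣-resp-≈ (Φ₅-cong (Φ₃-cong y≈r))) (∣-resp-≈ (Φ₅-cong (H-cong y≈r))))

eleven-divides-factor : ∀ y → ¬ 11 ∣ Φ₅ (suc y) → 11 ∣ Φ₅ (Φ₃ y) ⊎ 11 ∣ Φ₅ (H y)
eleven-divides-factor y 11∤Φ₅y+1 = drop-first (eleven-divides y)
  where
  drop-first : ElevenDividesΦ₅ y → 11 ∣ Φ₅ (Φ₃ y) ⊎ 11 ∣ Φ₅ (H y)
  drop-first (inj₁ 11∣Φ₅y+1) = contradiction 11∣Φ₅y+1 11∤Φ₅y+1
  drop-first (inj₂ 11∣Φ₅-factor) = 11∣Φ₅-factor

lemma7 : (x : ℕ) → Prime x → Prime (Φ₅ x) →
    (∃[ p ] ∃[ q ] (Prime p × Prime q × p ≢ q × p ∣ Φ₃ (Φ₅ x) × q ∣ Φ₃ (Φ₅ x)))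
    × (∀ b c → Prime b → Prime c → b ≢ c → Φ₃ (Φ₅ x) ≡ b * c →
        (11 ∣ Φ₅ b) ⊎ (11 ∣ Φ₅ c))
lemma7 0 prime-0 _ = contradiction (prime⇒1<p prime-0) (λ ())
lemma7 1 prime-1 _ = contradiction (prime⇒1<p prime-1) (<-irrefl refl)
lemma7 (suc y@(suc z)) prime-x prime-a =
  subst TwoPrimeDivisors (sym Φ₃a≡Φ₃y*Hy)
    (two-prime-divisors (from-yes (prime? 31)) (Φ₃>1 z) H>1 (Φ₃≢31 y prime-x) (>⇒≢ (H>31 z))
      (Φ₃-H-common-divisor y))
  , λ b c prime-b prime-c _ Φ₃a≡bc →
      prime-product-transfer (λ u → 11 ∣ Φ₅ u) prime-b prime-c (Φ₃>1 z) H>1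
        (trans (sym Φ₃a≡Φ₃y*Hy) Φ₃a≡bc)
        (eleven-divides-factor y (Φ₅-prime⇒11∤ (s≤s (s≤s z≤n)) prime-a))
  where
  Φ₃a≡Φ₃y*Hy : Φ₃ (Φ₅ (suc y)) ≡ Φ₃ y * H y
  Φ₃a≡Φ₃y*Hy = Φ₃∘Φ₅-factorisation y
  H>1 : 1 < H y
  H>1 = <-trans (from-yes (1 <? 31)) (H>31 z)
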